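{- For a finite alphabet $X$, a partition $\lambda$ and a scalar $c$, \[ R_{\lambda}(cX;b)=c^{|\lambda|}R_{\lambda}(X;bc), \] where $cX=\{cx\mid x\in X\}$.
   Context: Fix $|q|<1$ and $t$. $(b)_\infty=\prod_{i\ge0}(1-bq^i)$, $(b)_k=(b)_\infty/(bq^k)_\infty$, and for a partition $\lambda$, $(b)_\lambda=\prod_{i=1}^{l(\lambda)}(bt^{1-i})_{\lambda_i}$. $P_\lambda=P_\lambda(\cdot;q,t)$ are Macdonald polynomials; skew ones by $P_\lambda(X+Y)=\sum_\mu P_{\lambda/\mu}(Y)P_\mu(X)$, $P_{\lambda/\mu}=0$ if $\mu\not\subseteq\lambda$. For $X=\{x_1,\dots,x_n\}$, $R_\lambda(X;b)$ is defined by $R_\lambda(\emptyset;b)=\delta_{\lambda,0}$ and $R_{\lambda}(x_1,\dots,x_n;b)=\sum_{\mu\subseteq\lambda}\frac{(bx_n/t)_{\mu}}{(bx_n)_{\lambda}}P_{\lambda/\mu}(x_n)R_{\mu}(x_1,\dots,x_{n-1};b)$; it is symmetric in the $x_i$. -}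

module Defs where

open import Level using (Level; _⊔_) renaming (suc to lsuc)
open import Algebra.Bundles using (CommutativeRing)
open import Data.Bool using (Bool; true; false; if_then_else_; _∧_)
open import Data.Nat as ℕ using (ℕ; zero; suc; _∸_; _≤ᵇ_; _<ᵇ_; _≡ᵇ_)
open import Data.List using (List; []; _∷_; map; foldr; concatMap; filter; length; reverse; upTo; applyUpTo)
open import Data.List.Relation.Unary.All using (All)
open import Data.List.Relation.Unary.Linked using (Linked)
open import Data.Product using (_×_; _,_)
open import Relation.Nullary using (¬_)
open import Relation.Binary.PropositionalEquality using (_≡_)

-- Scalars: a field, with a total inverse (x⁻¹ is the usual inverse for
-- x ≉ 0, and 0⁻¹ = 0 by convention).

record TotalField (a ℓ : Level) : Set (lsuc (a ⊔ ℓ)) where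
  field
    commutativeRing : CommutativeRing a ℓ
  open CommutativeRing commutativeRing public
  field
    _⁻¹      : Carrier → Carrier
    ⁻¹-cong  : ∀ {x y} → x ≈ y → (x ⁻¹) ≈ (y ⁻¹)
    inverseʳ : ∀ x → ¬ (x ≈ 0#) → (x * (x ⁻¹)) ≈ 1#
    0⁻¹≈0    : (0# ⁻¹) ≈ 0#
    1≉0      : ¬ (1# ≈ 0#)

IsPartition : List ℕ → Set
IsPartition λ′ = Linked ℕ._≥_ λ′ × All (ℕ._<_ 0) λ′

size : List ℕ → ℕ
size = foldr ℕ._+_ 0

filterB : {A : Set} → (A → Bool) → List A → List A
filterB p []       = []
filterB p (x ∷ xs) = if p x then x ∷ filterB p xs else filterB p xs

-- λ_i (1-indexed; 0 beyond the length)
part : List ℕ → ℕ → ℕ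
part []       _             = 0
part (x ∷ xs) zero          = 0
part (x ∷ xs) (suc zero)    = x
part (x ∷ xs) (suc (suc i)) = part xs (suc i)

conj : List ℕ → ℕ → ℕ
conj λ′ j = length (filter (λ x → j ℕ.≤? x) λ′)

-- 1..n
range : ℕ → List ℕ
range n = applyUpTo suc n

weaklyDecreasing : List ℕ → Bool
weaklyDecreasing []           = true
weaklyDecreasing (x ∷ [])     = true
weaklyDecreasing (x ∷ y ∷ xs) = (y ≤ᵇ x) ∧ weaklyDecreasing (y ∷ xs)

boxChoices : List ℕ → List (List ℕ)
boxChoices []       = [] ∷ []
boxChoices (x ∷ xs) =
  concatMap (λ k → map (k ∷_) (boxChoices xs)) (upTo (suc x))

stripZeros : List ℕ → List ℕ
stripZeros = filter (λ x → 1 ℕ.≤? x)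

-- all partitions μ ⊆ λ (each exactly once)
subPartitions : List ℕ → List (List ℕ)
subPartitions λ′ =
  map stripZeros (filterB weaklyDecreasing (boxChoices λ′))

allB : List Bool → Bool
allB = foldr _∧_ true

isHStrip : List ℕ → List ℕ → Bool
isHStrip λ′ μ =
  (length μ ≤ᵇ length λ′) ∧
  allB (map (λ i → (part μ i ≤ᵇ part λ′ i) ∧ (part λ′ (suc i) ≤ᵇ part μ i))
            (range (length λ′)))

-- boxes (i , j) of a diagram, 1-indexed
boxes : List ℕ → List (ℕ × ℕ)
boxes μ = concatMap (λ i → map (λ j → (i , j)) (range (part μ i))) (range (length μ))

module Macdonald {a ℓ : Level} (F : TotalField a ℓ) (q t : TotalField.Carrier F) where
  open TotalField F

  infixr 8 _^_
  _^_ : Carrier → ℕ → Carrier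
  x ^ zero  = 1#
  x ^ suc n = x * (x ^ n)

  prod : List Carrier → Carrier
  prod = foldr _*_ 1#

  Sum : List Carrier → Carrier
  Sum = foldr _+_ 0#

  _/_ : Carrier → Carrier → Carrier
  x / y = x * (y ⁻¹)

  poch : Carrier → ℕ → Carrier
  poch b k = prod (map (λ i → 1# - (b * (q ^ i))) (upTo k))

  pochP : Carrier → List ℕ → Carrier
  pochP b λ′ = prod (map (λ i → poch (b * ((t ⁻¹) ^ (i ∸ 1))) (part λ′ i)) (range (length λ′)))

  bfun : List ℕ → ℕ × ℕ → Carrier
  bfun λ′ (i , j) =
    (1# - ((q ^ arm) * (t ^ suc leg))) / (1# - ((q ^ suc arm) * (t ^ leg)))
    where
      arm = part λ′ i ∸ j
      leg = conj λ′ j ∸ i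

  -- ψ_{λ/μ} = ∏_{s ∈ R_{λ/μ} − C_{λ/μ}} b_μ(s)/b_λ(s)   (Macdonald VI (6.24)(ii))
  psi : List ℕ → List ℕ → Carrier
  psi λ′ μ =
    prod (map (λ s → bfun μ s / bfun λ′ s)
              (filterB inRC (boxes μ)))
    where
      -- s ∈ μ lies in a row meeting λ/μ and in a column not meeting λ/μ
      inRC : ℕ × ℕ → Bool
      inRC (i , j) = (part μ i <ᵇ part λ′ i) ∧ (conj λ′ j ≡ᵇ conj μ j)

  -- one-variable skew Macdonald polynomial P_{λ/μ}(x)  (Macdonald VI (7.13'))
  skewP : List ℕ → List ℕ → Carrier → Carrier
  skewP λ′ μ x = if isHStrip λ′ μ then psi λ′ μ * (x ^ (size λ′ ∸ size μ)) else 0#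

  -- R_λ with the variables listed as x_n, x_{n-1}, …, x_1
  Rrev : Carrier → List ℕ → List Carrier → Carrier
  Rrev b []        []       = 1#
  Rrev b (_ ∷ _)   []       = 0#
  Rrev b λ′        (x ∷ xs) =
    Sum (map (λ μ → ((pochP ((b * x) * (t ⁻¹)) μ / pochP (b * x) λ′)
                      * skewP λ′ μ x) * Rrev b μ xs)
             (subPartitions λ′))

  R : List ℕ → List Carrier → Carrier → Carrier
  R λ′ X b = Rrev b λ′ (reverse X)

-- Every summand of the branching rule defining R is homogeneous under x ↦ c x, b ↦ b / c:
-- the Pochhammer coefficient only depends on the product b x, and the one-variable
-- P_{λ/μ}(x) is a monomial of degree |λ| - |μ|.  Induction on the number of variables
-- then collects the factors c^{|λ| - |μ|} c^{|μ|} = c^{|λ|}.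
{-# OPTIONS --safe #-}
module Submission where

open import Defs
open import Level using (Level)
open import Data.Bool using (true; false)
open import Data.List using (List; []; _∷_; map; reverse; upTo; length)
open import Data.List.Properties using (reverse-map)
open import Data.List.Relation.Unary.All as All using (All; []; _∷_)
import Data.List.Relation.Unary.All.Properties as All
open import Data.Nat as ℕ using (ℕ; zero; suc; _≤_; _∸_; z≤n)
import Data.Nat.Properties as ℕ
open import Relation.Binary.PropositionalEquality as ≡ using (_≡_)
import Algebra.Properties.CommutativeSemiring.Exp as Exp
import Algebra.Properties.CommutativeSemigroup as CommSemigroupProperties

filterB-All : ∀ {A : Set} {P : A → Set} p {xs : List A} → All P xs → All P (filterB p xs)
filterB-All p {[]}     []         = []
filterB-All p {x ∷ xs} (px ∷ pxs) with p x
... | true  = px ∷ filterB-All p pxs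
... | false = filterB-All p pxs

boxChoices-size≤ : ∀ λ′ → All (λ v → size v ≤ size λ′) (boxChoices λ′)
boxChoices-size≤ []       = z≤n ∷ []
boxChoices-size≤ (x ∷ xs) =
  All.concat⁺ (All.map⁺ (All.map
    (λ k<1+x → All.map⁺ (All.map (ℕ.+-mono-≤ (ℕ.≤-pred k<1+x)) (boxChoices-size≤ xs)))
    (All.all-upTo (suc x))))

stripZeros-size≤ : ∀ v → size (stripZeros v) ≤ size v
stripZeros-size≤ []      = z≤n
stripZeros-size≤ (x ∷ v) with 0 ℕ.<ᵇ x
... | true  = ℕ.+-monoʳ-≤ x (stripZeros-size≤ v)
... | false = ℕ.≤-trans (stripZeros-size≤ v) (ℕ.m≤n+m _ x)

subPartitions-size≤ : ∀ λ′ → All (λ μ → size μ ≤ size λ′) (subPartitions λ′)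
subPartitions-size≤ λ′ =
  All.map⁺ (All.map (λ {v} v≤λ → ℕ.≤-trans (stripZeros-size≤ v) v≤λ)
                    (filterB-All weaklyDecreasing (boxChoices-size≤ λ′)))

module Homogeneity {a ℓ : Level} (F : TotalField a ℓ) (q t : TotalField.Carrier F) where
  open TotalField F
  open Macdonald F q t
  open Exp commutativeSemiring using (^-distrib-*; ^-homo-*) renaming (_^_ to _^ˢ_)
  open CommSemigroupProperties *-commutativeSemigroup using (x∙yz≈y∙xz)
  open import Relation.Binary.Reasoning.Setoid setoid

  ^≡^ˢ : ∀ x n → x ^ n ≡ x ^ˢ n
  ^≡^ˢ x zero    = ≡.refl
  ^≡^ˢ x (suc n) = ≡.cong (x *_) (^≡^ˢ x n)

  ^-homogeneous : ∀ c x {m n} → m ≤ n → (c * x) ^ (n ∸ m) * c ^ m ≈ c ^ n * x ^ (n ∸ m)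
  ^-homogeneous c x {m} {n} m≤n = begin
    (c * x) ^ (n ∸ m) * c ^ m             ≡⟨ ≡.cong₂ _*_ (^≡^ˢ (c * x) (n ∸ m)) (^≡^ˢ c m) ⟩
    (c * x) ^ˢ (n ∸ m) * c ^ˢ m           ≈⟨ *-congʳ (^-distrib-* c x (n ∸ m)) ⟩
    c ^ˢ (n ∸ m) * x ^ˢ (n ∸ m) * c ^ˢ m  ≈⟨ *-assoc _ _ _ ⟩
    c ^ˢ (n ∸ m) * (x ^ˢ (n ∸ m) * c ^ˢ m) ≈⟨ *-congˡ (*-comm _ _) ⟩
    c ^ˢ (n ∸ m) * (c ^ˢ m * x ^ˢ (n ∸ m)) ≈⟨ *-assoc _ _ _ ⟨
    c ^ˢ (n ∸ m) * c ^ˢ m * x ^ˢ (n ∸ m)  ≈⟨ *-congʳ (^-homo-* c (n ∸ m) m) ⟨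
    c ^ˢ (n ∸ m ℕ.+ m) * x ^ˢ (n ∸ m)     ≡⟨ ≡.cong (λ k → c ^ˢ k * x ^ˢ (n ∸ m)) (ℕ.m∸n+n≡m m≤n) ⟩
    c ^ˢ n * x ^ˢ (n ∸ m)                 ≡⟨ ≡.cong₂ (λ u v → u * v) (^≡^ˢ c n) (^≡^ˢ x (n ∸ m)) ⟨
    c ^ n * x ^ (n ∸ m)                   ∎

  skewP-homogeneous : ∀ λ′ μ c x → size μ ≤ size λ′ →
    skewP λ′ μ (c * x) * c ^ size μ ≈ c ^ size λ′ * skewP λ′ μ x
  skewP-homogeneous λ′ μ c x μ≤λ with isHStrip λ′ μ
  ... | false = trans (zeroˡ _) (sym (zeroʳ _))
  ... | true  = begin
    psi λ′ μ * (c * x) ^ (size λ′ ∸ size μ) * c ^ size μ    ≈⟨ *-assoc _ _ _ ⟩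
    psi λ′ μ * ((c * x) ^ (size λ′ ∸ size μ) * c ^ size μ)  ≈⟨ *-congˡ (^-homogeneous c x μ≤λ) ⟩
    psi λ′ μ * (c ^ size λ′ * x ^ (size λ′ ∸ size μ))       ≈⟨ x∙yz≈y∙xz _ _ _ ⟩
    c ^ size λ′ * (psi λ′ μ * x ^ (size λ′ ∸ size μ))       ∎

  prod-map-cong : ∀ {A : Set} {f g : A → Carrier} → (∀ i → f i ≈ g i) →
    ∀ xs → prod (map f xs) ≈ prod (map g xs)
  prod-map-cong f≈g []       = refl
  prod-map-cong f≈g (x ∷ xs) = *-cong (f≈g x) (prod-map-cong f≈g xs)

  poch-cong : ∀ {b b′} k → b ≈ b′ → poch b k ≈ poch b′ k
  poch-cong k b≈b′ = prod-map-cong (λ i → +-congˡ (-‿cong (*-congʳ b≈b′))) (upTo k)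

  pochP-cong : ∀ {b b′} λ′ → b ≈ b′ → pochP b λ′ ≈ pochP b′ λ′
  pochP-cong λ′ b≈b′ =
    prod-map-cong (λ i → poch-cong (part λ′ i) (*-congʳ b≈b′)) (range (length λ′))

  Sum-map-factor : ∀ {A : Set} {P : A → Set} {f g : A → Carrier} k →
    (∀ {i} → P i → f i ≈ k * g i) → ∀ {xs} → All P xs → Sum (map f xs) ≈ k * Sum (map g xs)
  Sum-map-factor k f≈kg []         = sym (zeroʳ k)
  Sum-map-factor k f≈kg (pi ∷ pxs) =
    trans (+-cong (f≈kg pi) (Sum-map-factor k f≈kg pxs)) (sym (distribˡ k _ _))

  expansionTerm : Carrier → List ℕ → Carrier → List Carrier → List ℕ → Carrier
  expansionTerm b λ′ x xs μ =
    (pochP (b * x * t ⁻¹) μ / pochP (b * x) λ′) * skewP λ′ μ x * Rrev b μ xs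

  Rrev-cons : ∀ b λ′ x xs →
    Rrev b λ′ (x ∷ xs) ≡ Sum (map (expansionTerm b λ′ x xs) (subPartitions λ′))
  Rrev-cons b []      x xs = ≡.refl
  Rrev-cons b (_ ∷ _) x xs = ≡.refl

  expansionTerm-homogeneous : ∀ b c λ′ μ x xs → size μ ≤ size λ′ →
    Rrev b μ (map (c *_) xs) ≈ c ^ size μ * Rrev (b * c) μ xs →
    expansionTerm b λ′ (c * x) (map (c *_) xs) μ ≈ c ^ size λ′ * expansionTerm (b * c) λ′ x xs μ
  expansionTerm-homogeneous b c λ′ μ x xs μ≤λ Rμ-homogeneous = begin
    A * S * Rrev b μ (map (c *_) xs)             ≈⟨ *-cong (*-congʳ A≈A′) Rμ-homogeneous ⟩
    A′ * S * (c ^ size μ * R′)                   ≈⟨ *-assoc _ _ _ ⟨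
    A′ * S * c ^ size μ * R′                     ≈⟨ *-congʳ (*-assoc _ _ _) ⟩
    A′ * (S * c ^ size μ) * R′                   ≈⟨ *-congʳ (*-congˡ (skewP-homogeneous λ′ μ c x μ≤λ)) ⟩
    A′ * (c ^ size λ′ * skewP λ′ μ x) * R′       ≈⟨ *-congʳ (x∙yz≈y∙xz _ _ _) ⟩
    c ^ size λ′ * (A′ * skewP λ′ μ x) * R′       ≈⟨ *-assoc _ _ _ ⟩
    c ^ size λ′ * (A′ * skewP λ′ μ x * R′)       ∎
    where
      A  = pochP (b * (c * x) * t ⁻¹) μ / pochP (b * (c * x)) λ′
      A′ = pochP (b * c * x * t ⁻¹) μ / pochP (b * c * x) λ′
      S  = skewP λ′ μ (c * x)
      R′ = Rrev (b * c) μ xs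
      A≈A′ : A ≈ A′
      A≈A′ = *-cong (pochP-cong μ (*-congʳ (sym (*-assoc b c x))))
                    (⁻¹-cong (pochP-cong λ′ (sym (*-assoc b c x))))

  Rrev-homogeneous : ∀ b c λ′ xs → Rrev b λ′ (map (c *_) xs) ≈ c ^ size λ′ * Rrev (b * c) λ′ xs
  Rrev-homogeneous b c []      []       = sym (*-identityʳ 1#)
  Rrev-homogeneous b c (_ ∷ _) []       = sym (zeroʳ _)
  Rrev-homogeneous b c λ′      (x ∷ xs) = begin
    Rrev b λ′ (c * x ∷ map (c *_) xs)
      ≡⟨ Rrev-cons b λ′ (c * x) (map (c *_) xs) ⟩
    Sum (map (expansionTerm b λ′ (c * x) (map (c *_) xs)) (subPartitions λ′))
      ≈⟨ Sum-map-factor (c ^ size λ′)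
           (λ {μ} μ≤λ → expansionTerm-homogeneous b c λ′ μ x xs μ≤λ (Rrev-homogeneous b c μ xs))
           (subPartitions-size≤ λ′) ⟩
    c ^ size λ′ * Sum (map (expansionTerm (b * c) λ′ x xs) (subPartitions λ′))
      ≡⟨ ≡.cong (c ^ size λ′ *_) (Rrev-cons (b * c) λ′ x xs) ⟨
    c ^ size λ′ * Rrev (b * c) λ′ (x ∷ xs) ∎

-- The identity holds for every list λ′.
mainTheorem19 : ∀ {a ℓ} (F : TotalField a ℓ) (q t : TotalField.Carrier F)
    (X : List (TotalField.Carrier F)) (λ′ : List ℕ) (b c : TotalField.Carrier F) →
    IsPartition λ′ →
    TotalField._≈_ F
      (Macdonald.R F q t λ′ (map (λ x → TotalField._*_ F c x) X) b)
      (TotalField._*_ F (Macdonald._^_ F q t c (size λ′))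
        (Macdonald.R F q t λ′ X (TotalField._*_ F b c)))
mainTheorem19 F q t X λ′ b c _
  rewrite ≡.sym (reverse-map (TotalField._*_ F c) X) = Homogeneity.Rrev-homogeneous F q t b c λ′ (reverse X)
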